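{- (a) A signed graph $\Sigma$ is balanced if and only if the signed graph obtained from $\Sigma$ by suppressing all possible divalent vertices is balanced. (b) A signed graph $\Sigma$ obtained by Construction A is balanced if and only if, for each nontrivial block $B$ of $\Sigma$, the following holds: after suppressing all possible divalent vertices of $B$ (with degrees measured in $B$), the negative edge set is empty or a cut. (c) Every signed graph $\Sigma$ obtained by Construction D is balanced.
   Context: Graphs and signs. - Graphs may have loops and multiple edges; a loop contributes $2$ to the degree of its vertex. - A signed graph $\Sigma=(\Gamma,\sigma)$ is a graph $\Gamma$ with $\sigma:E\to\{+1,-1\}$. The sign of a path or circle is the product of its edge signs. $\Sigma$ is balanced if every circle is positive. - A cut is the nonempty set of edges between $X$ and $V\setminus X$ for some $X\subset V$. Suppression and subdivision. - Suppressing a divalent vertex $v$ with edges $uv,vw$ replaces them by one edge $uw$ of sign $\sigma(uv)\sigma(vw)$. A divalent vertex supporting a loop cannot be suppressed. - "Suppressing all possible divalent vertices" means repeating this until only loop-supporting divalent vertices remain. - Subdividing an edge $e'$ replaces it by a nontrivial path $P_{e'}$ with the same termini, or by a circle if $e'$ is a loop. Retaining the edge counts as a subdivision. Blocks and paths. - A block is a maximal subgraph in which any two edges lie on a common circle; isolated vertices, isthmi and loops are blocks. A block is nontrivial if it contains a circle. - A megablock is a maximal connected union of nontrivial blocks. - Paths may be open or closed, with termini equal for a closed path. A path is nontrivial if it has positive length; internal vertices are the non-termini; terminal edges are those incident with a terminus. - For a subgraph $\Gamma'$, a $\Gamma'$-divalent path or circle is a nontrivial path or circle in $\Gamma'$ whose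 internal vertices have degree $2$ in $\Gamma'$. Construction A. Start with a graph $\Gamma$. Choose pairwise disjoint paths and circles $P$, each of which is one of: (i) a $B$-divalent path in a nontrivial block $B$, with all vertices of degree $\le3$ in $\Gamma$ and termini of degree $2$; (ii) a path of isthmi, with all vertices of degree $\le3$ and termini of degree $\le2$; (iii) a megablock that is a circle, with all vertices of degree $\le3$. Make the chosen edges negative and all others positive. Construction D. Start with a graph $\Gamma'$ having no divalent vertices except possibly loop-supporting ones. - Step 1: sign $\Gamma'$ so that each nontrivial block is balanced, obtaining $\Sigma'$. - Step 2: choose $F'$ containing all negative edges of $\Sigma'$. - Step 3: partition $F'$ into a set $\mathcal D'$ of nontrivial paths and circles such that: (a) internal vertices have degree $\le3$; (b) the third edge at a trivalent internal vertex is an isthmus; (c) each open path lies in a nontrivial block or consists of isthmi; (d) no terminus is divalent in $\Gamma'$. - Step 4: subdivide each edge $e'$ into $P_{e'}$, giving $\Gamma$. For $P'\in\mathcal D'$, let $P$ be its subdivision. - Step 5: make $P_{e'}$ all positive for $e'\notin F'$. - Step 6: sign each $P$ so that for each edge $f'$ of $P'$: (a) the sign of $P_{f'}$ equals $\sigma'(f')$; (b) $P_{f'}$ is not all positive; (c) a terminal edge of $P$ at a non-univalent terminus is positive; (d) every edge of $P$ at a trivalent internal vertex is negative. -}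

module Defs where

open import Data.Nat using (ℕ; zero; suc; _≤_; _+_)
open import Data.Fin using (Fin; zero; suc; inject₁; fromℕ; punchIn; _≟_)
open import Data.List using (List; []; _∷_; length; lookup; map)
open import Data.Nat.ListAction using (sum)
open import Data.List.Relation.Binary.Permutation.Propositional using (_↭_)
open import Data.List.Relation.Binary.Pointwise using (Pointwise)
open import Data.Sign using (Sign) renaming (_*_ to _·_; + to ⊕; - to ⊖)
open import Data.Bool using (Bool; true; false; if_then_else_; T)
open import Data.Product using (Σ; ∃; ∃-syntax; _×_; _,_)
open import Data.Sum using (_⊎_)
open import Data.Empty using (⊥)
open import Relation.Nullary using (¬_; does)
open import Relation.Binary.PropositionalEquality using (_≡_; _≢_)
open import Relation.Binary.Construct.Closure.ReflexiveTransitive using (Star)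
open import Function using (_⇔_)

-- Vertices are Fin n; the edges form a list (so multiple
-- edges and loops are allowed); an edge is identified by its position in
-- the list.  The orientation end₁/end₂ of an edge is irrelevant: every
-- notion below is symmetric in the two ends.  An unsigned graph is the
-- underlying graph of a signed one (all graph notions ignore signs).

record Edge (n : ℕ) : Set where
  constructor edge
  field
    end₁ end₂ : Fin n
    sgn       : Sign
open Edge public

record SGraph : Set where
  constructor sgraph
  field
    nv    : ℕ
    edges : List (Edge nv)
open SGraph public

module _ {n : ℕ} where

  EIdx : List (Edge n) → Set
  EIdx E = Fin (length E)

  record ESet (E : List (Edge n)) : Set where
    constructor eset
    field
      mem : EIdx E → Bool
  open ESet public

  _∈ₑ_ : {E : List (Edge n)} → EIdx E → ESet E → Set
  e ∈ₑ S = T (mem S e)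

  _⊆ₑ_ : {E : List (Edge n)} → ESet E → ESet E → Set
  S ⊆ₑ S' = ∀ e → e ∈ₑ S → e ∈ₑ S'

  Joins : Edge n → Fin n → Fin n → Set
  Joins e x y = (end₁ e ≡ x × end₂ e ≡ y) ⊎ (end₁ e ≡ y × end₂ e ≡ x)

  IncidentTo : Edge n → Fin n → Set
  IncidentTo e v = end₁ e ≡ v ⊎ end₂ e ≡ v

  -- number of ends of e at v (a loop at v counts 2)
  incid : Fin n → Edge n → ℕ
  incid v e = (if does (end₁ e ≟ v) then 1 else 0)
            + (if does (end₂ e ≟ v) then 1 else 0)

  deg : List (Edge n) → Fin n → ℕ
  deg E v = sum (map (incid v) E)

  LoopAt : List (Edge n) → Fin n → Set
  LoopAt E v = ∃[ i ] (end₁ (lookup E i) ≡ v × end₂ (lookup E i) ≡ v)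

  -- the spanning subgraph with edge set S (same vertex set)
  restrict : (E : List (Edge n)) → ESet E → List (Edge n)
  restrict []      S = []
  restrict (e ∷ E) S = if mem S zero then e ∷ restrict E (eset (λ i → mem S (suc i)))
                                     else restrict E (eset (λ i → mem S (suc i)))

  -- A path of length
  -- suc len has vertices vert 0 .. vert (suc len) and edges edg 0 .. edg len,
  -- edge j joining vert j and vert (j+1); edges are distinct and vertices are
  -- distinct except that the two termini may coincide (closed path).

  record Trail (E : List (Edge n)) : Set where
    field
      len      : ℕ
      vert     : Fin (suc (suc len)) → Fin n
      edg      : Fin (suc len) → EIdx E
      joins    : ∀ j → Joins (lookup E (edg j)) (vert (inject₁ j)) (vert (suc j))
      edg-inj  : ∀ i j → edg i ≡ edg j → i ≡ j
      init-inj : ∀ i j → vert (inject₁ i) ≡ vert (inject₁ j) → i ≡ j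
      tail-inj : ∀ i j → vert (suc i) ≡ vert (suc j) → i ≡ j
  open Trail public

  module _ {E : List (Edge n)} where

    first last : Trail E → Fin n
    first P = vert P zero
    last  P = vert P (fromℕ (suc (len P)))

    Closed Open : Trail E → Set
    Closed P = first P ≡ last P
    Open   P = ¬ Closed P

    HasEdge : Trail E → EIdx E → Set
    HasEdge P e = ∃[ j ] (edg P j ≡ e)

    VertexOf : Trail E → Fin n → Set
    VertexOf P v = ∃[ i ] (vert P i ≡ v)

    Terminus : Trail E → Fin n → Set
    Terminus P v = first P ≡ v ⊎ last P ≡ v

    InternalP : (P : Trail E) → Fin n → Set
    InternalP P v = ∃[ i ] (vert P (suc (inject₁ i)) ≡ v)

    TrailIn : ESet E → Trail E → Set
    TrailIn S P = ∀ j → edg P j ∈ₑ S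

  prodSign : (k : ℕ) → (Fin k → Sign) → Sign
  prodSign zero    f = ⊕
  prodSign (suc k) f = f zero · prodSign k (λ i → f (suc i))

  trailSign : {E : List (Edge n)} → Trail E → Sign
  trailSign {E} P = prodSign (suc (len P)) (λ j → sgn (lookup E (edg P j)))

  -- a circle is (traversed as) a closed path
  Balanced : List (Edge n) → Set
  Balanced E = ∀ (C : Trail E) → Closed C → trailSign C ≡ ⊕

  Isthmus : (E : List (Edge n)) → EIdx E → Set
  Isthmus E e = ¬ (∃[ C ] (Closed {E} C × HasEdge C e))

  Cocircular : (E : List (Edge n)) → ESet E → Set
  Cocircular E S = ∀ e f → e ∈ₑ S → f ∈ₑ S →
    ∃[ C ] (Closed {E} C × TrailIn S C × HasEdge C e × HasEdge C f)

  NontrivialBlock : (E : List (Edge n)) → ESet E → Set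
  NontrivialBlock E S = (∃[ e ] (e ∈ₑ S)) × Cocircular E S
    × (∀ S' → S ⊆ₑ S' → Cocircular E S' → S' ⊆ₑ S)

  UnionOfNTBlocks : (E : List (Edge n)) → ESet E → Set
  UnionOfNTBlocks E M = ∀ e → e ∈ₑ M →
    ∃[ B ] (NontrivialBlock E B × e ∈ₑ B × B ⊆ₑ M)

  StepIn : (E : List (Edge n)) → ESet E → Fin n → Fin n → Set
  StepIn E M x y = ∃[ i ] (i ∈ₑ M × Joins (lookup E i) x y)

  ConnectedE : (E : List (Edge n)) → ESet E → Set
  ConnectedE E M = ∀ e f → e ∈ₑ M → f ∈ₑ M →
    Star (StepIn E M) (end₁ (lookup E e)) (end₁ (lookup E f))

  Megablock : (E : List (Edge n)) → ESet E → Set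
  Megablock E M = (∃[ e ] (e ∈ₑ M)) × UnionOfNTBlocks E M × ConnectedE E M
    × (∀ M' → M ⊆ₑ M' → UnionOfNTBlocks E M' → ConnectedE E M' → M' ⊆ₑ M)

  IsCut : (E : List (Edge n)) → (EIdx E → Set) → Set
  IsCut E N = (∃[ e ] N e) × Σ (Fin n → Bool) λ X → (∀ e → N e ⇔ (X (end₁ (lookup E e)) ≢ X (end₂ (lookup E e))))

  Negative : (E : List (Edge n)) → EIdx E → Set
  Negative E e = sgn (lookup E e) ≡ ⊖

  NegEmptyOrCut : List (Edge n) → Set
  NegEmptyOrCut E = (∀ e → sgn (lookup E e) ≡ ⊕) ⊎ IsCut E (Negative E)

-- Suppression of a divalent vertex v (not supporting a loop): the two edges
-- e₁ = uv, e₂ = vw are replaced by one edge uw of sign σ(e₁)σ(e₂), and v is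
-- deleted (the remaining vertices are renumbered by punchIn v).

RenamedFrom : ∀ {n} → Fin (suc n) → Edge n → Edge (suc n) → Set
RenamedFrom v e' e = punchIn v (end₁ e') ≡ end₁ e × punchIn v (end₂ e') ≡ end₂ e × sgn e' ≡ sgn e

data Suppress : SGraph → SGraph → Set where
  suppress : ∀ {n} {E : List (Edge (suc n))} (v : Fin (suc n))
    (e₁ e₂ : Edge (suc n)) (rest : List (Edge (suc n)))
    (u w : Fin n) (rest' : List (Edge n)) →
    E ↭ (e₁ ∷ e₂ ∷ rest) →
    Joins e₁ (punchIn v u) v → Joins e₂ v (punchIn v w) →
    Pointwise (RenamedFrom v) rest' rest →
    Suppress (sgraph (suc n) E) (sgraph n (edge u w (sgn e₁ · sgn e₂) ∷ rest'))

NoSuppressible : SGraph → Set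
NoSuppressible (sgraph n E) = ∀ v → deg E v ≡ 2 → LoopAt E v

SuppressAll : SGraph → SGraph → Set
SuppressAll Σ₀ Σ₁ = Star Suppress Σ₀ Σ₁ × NoSuppressible Σ₁

-- Construction A (the underlying graph Γ of E is the starting graph)

module _ {n : ℕ} (E : List (Edge n)) where

  BDivalent : ESet E → Trail E → Set
  BDivalent B P = TrailIn B P × (∀ v → InternalP P v → deg (restrict E B) v ≡ 2)

  AllDeg≤3 : Trail E → Set
  AllDeg≤3 P = ∀ v → VertexOf P v → deg E v ≤ 3

  data AItem : Set where
    blockPath : (B : ESet E) → NontrivialBlock E B → (P : Trail E) → BDivalent B P →
      AllDeg≤3 P → (∀ v → Terminus P v → deg E v ≡ 2) → AItem
    isthmusPath : (P : Trail E) → (∀ j → Isthmus E (edg P j)) →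
      AllDeg≤3 P → (∀ v → Terminus P v → deg E v ≤ 2) → AItem
    megaCircle : (M : ESet E) → Megablock E M → (C : Trail E) → Closed C →
      (∀ e → e ∈ₑ M ⇔ HasEdge C e) → AllDeg≤3 C → AItem

  itemTrail : AItem → Trail E
  itemTrail (blockPath _ _ P _ _ _) = P
  itemTrail (isthmusPath P _ _ _)   = P
  itemTrail (megaCircle _ _ C _ _ _) = C

  ConstructionA : Set
  ConstructionA = Σ ℕ λ k → Σ (Fin k → AItem) λ items →
      ((∀ (i j : Fin k) v → i ≢ j → VertexOf (itemTrail (items i)) v →
                                     VertexOf (itemTrail (items j)) v → ⊥)
    × (∀ e → Negative E e ⇔ (∃[ i ] HasEdge (itemTrail (items i)) e)))

module _ {n' : ℕ} (E' : List (Edge n')) where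

  data DItem : Set where
    dpath   : Trail E' → DItem
    dcircle : (C : Trail E') → Closed C → DItem

  dTrail : DItem → Trail E'
  dTrail (dpath P)     = P
  dTrail (dcircle C _) = C

  -- internal vertices (= non-termini; every vertex of a circle)
  DInternal : DItem → Fin n' → Set
  DInternal (dpath P)     v = InternalP P v
  DInternal (dcircle C _) v = VertexOf C v

  DTerminus : DItem → Fin n' → Set
  DTerminus (dpath P)     v = Terminus P v
  DTerminus (dcircle C _) v = ⊥

  DEdge : DItem → EIdx E' → Set
  DEdge D e = HasEdge (dTrail D) e

  Step3OK : DItem → Set
  Step3OK D =
      (∀ v → DInternal D v → deg E' v ≤ 3)
    × (∀ v → DInternal D v → deg E' v ≡ 3 →
         ∀ e → IncidentTo (lookup E' e) v → ¬ DEdge D e → Isthmus E' e)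
    × (∀ P → D ≡ dpath P → Open P →
         (∃[ B ] (NontrivialBlock E' B × TrailIn B P)) ⊎ (∀ j → Isthmus E' (edg P j)))
    × (∀ v → DTerminus D v → ¬ (deg E' v ≡ 2))

-- Γ (edge list E) is a subdivision of Γ' (edge list E'): ι embeds the
-- vertices of Γ', and each edge e' is replaced by the path (or circle)
-- sub e' with the same termini.
record Subdivision {n' n : ℕ} (E' : List (Edge n')) (E : List (Edge n)) : Set where
  field
    ι        : Fin n' → Fin n
    ι-inj    : ∀ x y → ι x ≡ ι y → x ≡ y
    sub      : EIdx E' → Trail E
    sub-first : ∀ e' → first (sub e') ≡ ι (end₁ (lookup E' e'))
    sub-last  : ∀ e' → last (sub e') ≡ ι (end₂ (lookup E' e'))
    internal-new : ∀ e' v → InternalP (sub e') v → ∀ x → ι x ≢ v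
    internal-disj : ∀ e' f' v → InternalP (sub e') v → VertexOf (sub f') v → e' ≡ f'
    edge-cover : ∀ e → ∃[ e' ] HasEdge (sub e') e
    edge-uniq  : ∀ e e' f' → HasEdge (sub e') e → HasEdge (sub f') e → e' ≡ f'
    vertex-cover : ∀ v → (∃[ x ] (ι x ≡ v)) ⊎ (∃[ e' ] InternalP (sub e') v)
open Subdivision public

-- Σ (edge list E with signs) is obtained from Γ' (underlying graph of E')
-- by Construction D, using the signing Σ' = E' (Step 1).
ConstructionD : ∀ {n' n} → List (Edge n') → List (Edge n) → Set
ConstructionD {n'} {n} E' E =
    (∀ v → deg E' v ≡ 2 → LoopAt E' v)
  × (∀ B → NontrivialBlock E' B → Balanced (restrict E' B))
  × Σ (ESet E') λ F' →
    (∀ e' → Negative E' e' → e' ∈ₑ F')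
  × Σ ℕ λ k → Σ (Fin k → DItem E') λ 𝒟 →
    (∀ i → ∀ e' → DEdge E' (𝒟 i) e' → e' ∈ₑ F')
  × (∀ e' → e' ∈ₑ F' → ∃[ i ] DEdge E' (𝒟 i) e')
  × (∀ e' i j → DEdge E' (𝒟 i) e' → DEdge E' (𝒟 j) e' → i ≡ j)
  × (∀ i → Step3OK E' (𝒟 i))
  × Σ (Subdivision E' E) λ S →
    let
      -- edges of P, the subdivision of the i-th member P' of 𝒟
      PEdge : Fin k → EIdx E → Set
      PEdge i e = ∃[ f' ] (DEdge E' (𝒟 i) f' × HasEdge (sub S f') e)
      PInternal : Fin k → Fin n → Set
      PInternal i v = (∃[ x ] (ι S x ≡ v × DInternal E' (𝒟 i) x))
                    ⊎ (∃[ f' ] (DEdge E' (𝒟 i) f' × InternalP (sub S f') v))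
    in
    (∀ e' → ¬ (e' ∈ₑ F') → ∀ e → HasEdge (sub S e') e → sgn (lookup E e) ≡ ⊕)
  × (∀ i f' → DEdge E' (𝒟 i) f' →
        (trailSign (sub S f') ≡ sgn (lookup E' f'))
      × (∃[ e ] (HasEdge (sub S f') e × Negative E e)))
  × (∀ i x → DTerminus E' (𝒟 i) x → ¬ (deg E (ι S x) ≡ 1) →
        ∀ e → PEdge i e → IncidentTo (lookup E e) (ι S x) → sgn (lookup E e) ≡ ⊕)
  × (∀ i v → PInternal i v → deg E v ≡ 3 →
        ∀ e → PEdge i e → IncidentTo (lookup E e) v → Negative E e)

module Submission where

-- A potential for a signed graph is a map X from vertices to signs such that
-- every edge has sign X(end₁)·X(end₂).  The whole lemma reduces to the classical
-- fact (Harary) that a signed graph is balanced iff it has a potential: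
--   * potential ⇒ balanced: the sign of a circle telescopes to X(v)·X(v) = ⊕;
--   * balanced ⇒ potential: extend a potential edge by edge; when a new edge does
--     not fit, its ends lie in different components (a connecting path would close
--     to a negative circle), so switching one component repairs it.  This is proved
--     under double negation and made constructive because having a potential is
--     decidable (finitely many candidates).
-- Then (a) holds because suppressing a divalent vertex preserves potentials both
-- ways; (b) because a graph is balanced iff its nontrivial blocks are (every circle
-- lies in a block) and a graph has a potential iff its negative edges are none or a
-- cut -- this holds for every signed graph.

open import Defs
open import Data.Bool using (Bool; true; false; T; if_then_else_)
open import Data.Bool.Properties using (T-≡)
open import Data.Empty using (⊥-elim)
open import Data.Fin using (Fin; zero; suc; inject₁; fromℕ; punchIn; punchOut; _≟_)
open import Data.Fin.Properties using (any?; all?; ¬∀⟶∃¬; sequence; inject₁-injective; fromℕ≢inject₁; suc-injective; punchIn-punchOut)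
open import Data.Fin.Subset using (Subset; ∣_∣) renaming (_∈_ to _∈ˢ_)
open import Data.Fin.Subset.Properties using (anySubset?; ∣p∣≤n; p⊂q⇒∣p∣<∣q∣)
open import Data.List using (List; []; _∷_; _++_; length; lookup)
open import Data.List.Membership.Propositional using (_∈_; _∉_)
open import Data.List.Membership.Propositional.Properties using (∈-lookup)
import Data.List.Membership.DecPropositional as DecMembership
open import Data.List.Relation.Binary.Permutation.Propositional using (_↭_; ↭-sym; ↭-trans; ↭-refl; prep)
open import Data.List.Relation.Binary.Permutation.Propositional.Properties using (All-resp-↭; shift)
open import Data.List.Relation.Binary.Pointwise using (Pointwise; []; _∷_)
open import Data.List.Relation.Unary.All as All using (All; []; _∷_)
open import Data.List.Relation.Unary.Any using (here; there)
open import Data.Nat using (ℕ; zero; suc; _+_; _≤_; _<_)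
import Data.Nat as ℕ
open import Data.Nat.Properties using (≤-trans; ≤-reflexive; <⇒≱; +-suc; +-identityʳ; m≤n+m; +-monoˡ-≤)
open import Data.Product using (Σ; ∃-syntax; _×_; _,_; proj₁; proj₂)
open import Data.Sign using (Sign; opposite) renaming (_*_ to _·_; + to ⊕; - to ⊖)
open import Data.Sign.Properties using (*-assoc; *-comm; s*s≡+; *-identityʳ; *-cancelʳ-≡) renaming (_≟_ to _≟ₛ_)
open import Data.Sum using (_⊎_; inj₁; inj₂; [_,_])
import Data.Vec as Vec
open import Data.Vec.Properties using (lookup∘tabulate; []=⇒lookup; lookup⇒[]=)
open import Data.Vec.Functional using (insertAt)
open import Data.Vec.Functional.Properties using (insertAt-lookup; insertAt-punchIn)
open import Effect.Monad using (RawMonad)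
open import Function using (_∘_; id; _⇔_; mk⇔; Equivalence)
open import Function.Construct.Composition using (_⇔-∘_)
open import Function.Construct.Symmetry using (⇔-sym)
import Level
open import Relation.Binary.Construct.Closure.ReflexiveTransitive using (Star; ε; _◅_; _◅◅_)
open import Relation.Binary.PropositionalEquality using (_≡_; _≢_; refl; sym; trans; cong; cong₂; subst; module ≡-Reasoning)
open import Relation.Nullary using (¬_; Dec; yes; no; does)
open import Relation.Nullary.Decidable using (T?; map′; decidable-stable; ¬¬-excluded-middle; isYes; toWitness; fromWitness; _×-dec_; _⊎-dec_; _→-dec_)
open import Relation.Nullary.Negation using (¬¬-Monad)
open import Relation.Unary using (Decidable)

open Equivalence using (to; from)
open RawMonad (¬¬-Monad {a = Level.zero}) using (return; _>>=_; _<$>_; rawApplicative)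
open ≡-Reasoning

·-cancelˡ-twice : ∀ a s → a · (a · s) ≡ s
·-cancelˡ-twice a s = begin
  a · (a · s) ≡⟨ *-assoc a a s ⟨
  (a · a) · s ≡⟨ cong (_· s) (s*s≡+ a) ⟩
  s           ∎

·-telescope : ∀ a b c → (a · b) · (b · c) ≡ a · c
·-telescope a b c = begin
  (a · b) · (b · c) ≡⟨ *-assoc a b (b · c) ⟩
  a · (b · (b · c)) ≡⟨ cong (a ·_) (·-cancelˡ-twice b c) ⟩
  a · c             ∎

≢⇒opposite : ∀ {s t} → s ≢ t → s ≡ opposite t
≢⇒opposite {⊕} {⊕} s≢t = ⊥-elim (s≢t refl)
≢⇒opposite {⊕} {⊖} _   = refl
≢⇒opposite {⊖} {⊕} _   = refl
≢⇒opposite {⊖} {⊖} s≢t = ⊥-elim (s≢t refl)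

opposite-·-opposite : ∀ a b → opposite a · opposite b ≡ a · b
opposite-·-opposite ⊕ b = ·-cancelˡ-twice ⊖ b
opposite-·-opposite ⊖ b = refl

sign-ext : ∀ s t → (s ≡ ⊖ ⇔ t ≡ ⊖) → s ≡ t
sign-ext ⊕ ⊕ _ = refl
sign-ext ⊕ ⊖ s⇔t = from s⇔t refl
sign-ext ⊖ ⊕ s⇔t = sym (to s⇔t refl)
sign-ext ⊖ ⊖ _ = refl

-- Booleans code signs: true is the negative side.  A product is negative exactly
-- when its factors lie on different sides.
fromBool : Bool → Sign
fromBool true  = ⊖
fromBool false = ⊕

isNegative : Sign → Bool
isNegative ⊖ = true
isNegative ⊕ = false

fromBool-isNegative : ∀ s → fromBool (isNegative s) ≡ s
fromBool-isNegative ⊕ = refl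
fromBool-isNegative ⊖ = refl

·-negative⇔ : ∀ s t → (s · t ≡ ⊖) ⇔ (isNegative s ≢ isNegative t)
·-negative⇔ ⊕ ⊕ = mk⇔ (λ ()) (λ ne → ⊥-elim (ne refl))
·-negative⇔ ⊕ ⊖ = mk⇔ (λ _ ()) (λ _ → refl)
·-negative⇔ ⊖ ⊕ = mk⇔ (λ _ ()) (λ _ → refl)
·-negative⇔ ⊖ ⊖ = mk⇔ (λ ()) (λ ne → ⊥-elim (ne refl))

fromBool-·-negative⇔ : ∀ a b → (fromBool a · fromBool b ≡ ⊖) ⇔ (a ≢ b)
fromBool-·-negative⇔ true  true  = mk⇔ (λ ()) (λ ne → ⊥-elim (ne refl))
fromBool-·-negative⇔ true  false = mk⇔ (λ _ ()) (λ _ → refl)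
fromBool-·-negative⇔ false true  = mk⇔ (λ _ ()) (λ _ → refl)
fromBool-·-negative⇔ false false = mk⇔ (λ ()) (λ ne → ⊥-elim (ne refl))

prodSign-positive : ∀ {n} k (s : Fin k → Sign) → (∀ j → s j ≡ ⊕) → prodSign {n} k s ≡ ⊕
prodSign-positive zero    s pos = refl
prodSign-positive {n} (suc k) s pos =
  trans (cong (_· prodSign {n} k (s ∘ suc)) (pos zero)) (prodSign-positive {n} k (s ∘ suc) (pos ∘ suc))

All-tabulate : ∀ {A : Set} {P : A → Set} (xs : List A) → (∀ i → P (lookup xs i)) → All P xs
All-tabulate []       p = []
All-tabulate (x ∷ xs) p = p zero ∷ All-tabulate xs (p ∘ suc)

module _ {n : ℕ} where

  Fits : (Fin n → Sign) → Edge n → Set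
  Fits X e = sgn e ≡ X (end₁ e) · X (end₂ e)

  Potential : (Fin n → Sign) → List (Edge n) → Set
  Potential X E = All (Fits X) E

  Switchable : List (Edge n) → Set
  Switchable E = ∃[ X ] Potential X E

  fits-joins : ∀ X {e x y} → Fits X e → Joins e x y → sgn e ≡ X x · X y
  fits-joins X       fit (inj₁ (refl , refl)) = fit
  fits-joins X {e}   fit (inj₂ (refl , refl)) = trans fit (*-comm (X (end₁ e)) (X (end₂ e)))

  joins-fits : ∀ X {e x y} → Joins e x y → sgn e ≡ X x · X y → Fits X e
  joins-fits X       (inj₁ (refl , refl)) fit = fit
  joins-fits X {e}   (inj₂ (refl , refl)) fit = trans fit (*-comm (X (end₂ e)) (X (end₁ e)))

  potential-lookup : ∀ X {E} → Potential X E → ∀ i → Fits X (lookup E i)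
  potential-lookup X pot i = All.lookup pot (∈-lookup i)

  potential-cong : ∀ {X Y E} → (∀ v → X v ≡ Y v) → Potential Y E → Potential X E
  potential-cong X≗Y = All.map λ fit → trans fit (sym (cong₂ _·_ (X≗Y _) (X≗Y _)))

  prodSign-telescopes : (X : Fin n → Sign) (k : ℕ) (v : Fin (suc (suc k)) → Fin n)
    (s : Fin (suc k) → Sign) → (∀ j → s j ≡ X (v (inject₁ j)) · X (v (suc j))) →
    prodSign {n} (suc k) s ≡ X (v zero) · X (v (fromℕ (suc k)))
  prodSign-telescopes X zero    v s fit = trans (*-identityʳ (s zero)) (fit zero)
  prodSign-telescopes X (suc k) v s fit = begin
    s zero · prodSign {n} (suc k) (s ∘ suc)
      ≡⟨ cong₂ _·_ (fit zero) (prodSign-telescopes X k (v ∘ suc) (s ∘ suc) (fit ∘ suc)) ⟩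
    (X (v zero) · X (v (suc zero))) · (X (v (suc zero)) · X (v (fromℕ (suc (suc k)))))
      ≡⟨ ·-telescope (X (v zero)) (X (v (suc zero))) (X (v (fromℕ (suc (suc k))))) ⟩
    X (v zero) · X (v (fromℕ (suc (suc k)))) ∎

  trailSign-potential : ∀ X {E} → Potential X E → (P : Trail E) →
    trailSign P ≡ X (first P) · X (last P)
  trailSign-potential X pot P = prodSign-telescopes X (len P) (vert P) _
    (λ j → fits-joins X (potential-lookup X pot (edg P j)) (joins P j))

  -- a circle has sign X(v)·X(v) = ⊕
  switchable⇒balanced : ∀ {E} → Switchable E → Balanced E
  switchable⇒balanced (X , pot) C closed = begin
    trailSign C             ≡⟨ trailSign-potential X pot C ⟩
    X (first C) · X (last C) ≡⟨ cong (λ v → X (first C) · X v) closed ⟨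
    X (first C) · X (first C) ≡⟨ s*s≡+ (X (first C)) ⟩
    ⊕                        ∎

module _ {n : ℕ} where

  retarget : {E F : List (Edge n)} (P : Trail E) (g : Fin (suc (len P)) → EIdx F) →
    (∀ j → lookup F (g j) ≡ lookup E (edg P j)) → (∀ a b → g a ≡ g b → a ≡ b) → Trail F
  retarget P g same g-inj = record
    { len = len P ; vert = vert P ; edg = g
    ; joins = λ j → subst (λ e → Joins e _ _) (sym (same j)) (joins P j)
    ; edg-inj = g-inj ; init-inj = init-inj P ; tail-inj = tail-inj P }

  retarget-sign : {E F : List (Edge n)} (P : Trail E) (g : Fin (suc (len P)) → EIdx F) →
    (same : ∀ j → lookup F (g j) ≡ lookup E (edg P j)) → (g-inj : ∀ a b → g a ≡ g b → a ≡ b) →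
    trailSign (retarget {E = E} {F = F} P g same g-inj) ≡ trailSign P
  retarget-sign P g same g-inj = prodSign-cong (suc (len P)) (λ j → cong sgn (same j))
    where
    prodSign-cong : ∀ k {s t : Fin k → Sign} → (∀ j → s j ≡ t j) → prodSign {n} k s ≡ prodSign {n} k t
    prodSign-cong zero    s≗t = refl
    prodSign-cong (suc k) s≗t = cong₂ _·_ (s≗t zero) (prodSign-cong k (s≗t ∘ suc))

  -- A is a sublist of B up to reordering: an injective, edge-preserving index map
  record EdgeEmbedding (A B : List (Edge n)) : Set where
    field
      φ           : EIdx A → EIdx B
      φ-lookup    : ∀ i → lookup B (φ i) ≡ lookup A i
      φ-injective : ∀ i j → φ i ≡ φ j → i ≡ j
  open EdgeEmbedding

  embedTrail : ∀ {A B} → EdgeEmbedding A B → Trail A → Trail B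
  embedTrail m P = retarget P (φ m ∘ edg P) (φ-lookup m ∘ edg P)
    (λ a b eq → edg-inj P a b (φ-injective m _ _ eq))

  embedTrail-sign : ∀ {A B} (m : EdgeEmbedding A B) (P : Trail A) → trailSign (embedTrail m P) ≡ trailSign P
  embedTrail-sign {A} {B} m P = retarget-sign {E = A} {F = B} P (φ m ∘ edg P) (φ-lookup m ∘ edg P)
    (λ a b eq → edg-inj P a b (φ-injective m _ _ eq))

  balanced-embedding : ∀ {A B} → EdgeEmbedding A B → Balanced B → Balanced A
  balanced-embedding m bal P closed = trans (sym (embedTrail-sign m P)) (bal (embedTrail m P) closed)

  tail-embedding : ∀ {e : Edge n} {E} → EdgeEmbedding E (e ∷ E)
  tail-embedding = record { φ = suc ; φ-lookup = λ _ → refl ; φ-injective = λ _ _ → suc-injective }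

  balanced-tail : ∀ {e : Edge n} {E} → Balanced (e ∷ E) → Balanced E
  balanced-tail = balanced-embedding tail-embedding

joins-sym : ∀ {n} (e : Edge n) {x y} → Joins e x y → Joins e y x
joins-sym e (inj₁ p) = inj₂ p
joins-sym e (inj₂ p) = inj₁ p

joins-end : ∀ {n} (e : Edge n) {a b c d} → Joins e a b → Joins e c d → a ≡ c ⊎ a ≡ d
joins-end e (inj₁ (refl , refl)) (inj₁ (p , _)) = inj₁ p
joins-end e (inj₁ (refl , refl)) (inj₂ (p , _)) = inj₂ p
joins-end e (inj₂ (refl , refl)) (inj₁ (_ , q)) = inj₂ q
joins-end e (inj₂ (refl , refl)) (inj₂ (_ , q)) = inj₁ q


module _ {n : ℕ} {E : List (Edge n)} where

  VertexInjective : Trail E → Set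
  VertexInjective P = ∀ a b → vert P a ≡ vert P b → a ≡ b

  -- the trail consisting of a single edge (a loop gives a circle of length one)
  edgeTrail : (i : EIdx E) {x y : Fin n} → Joins (lookup E i) x y → Trail E
  edgeTrail i {x} {y} x~y = record
    { len = 0 ; vert = λ { zero → x ; (suc zero) → y } ; edg = λ _ → i
    ; joins = λ { zero → x~y }
    ; edg-inj = λ { zero zero _ → refl }
    ; init-inj = λ { zero zero _ → refl } ; tail-inj = λ { zero zero _ → refl } }

  edgeTrail-injective : (i : EIdx E) {x y : Fin n} (x~y : Joins (lookup E i) x y) → x ≢ y →
    VertexInjective (edgeTrail i x~y)
  edgeTrail-injective i x~y x≢y zero       zero       _  = refl
  edgeTrail-injective i x~y x≢y zero       (suc zero) eq = ⊥-elim (x≢y eq)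
  edgeTrail-injective i x~y x≢y (suc zero) zero       eq = ⊥-elim (x≢y (sym eq))
  edgeTrail-injective i x~y x≢y (suc zero) (suc zero) _  = refl

  -- prepend to a path P an unused edge i from a vertex x not among the non-final
  -- vertices of P (x may be the last vertex: then the result is a circle)
  prependEdge : (P : Trail E) {x : Fin n} (i : EIdx E) → Joins (lookup E i) x (first P) →
    (∀ j → edg P j ≢ i) → (∀ a → vert P (inject₁ a) ≢ x) → VertexInjective P → Trail E
  prependEdge P {x} i x~P unused fresh P-inj = record
    { len = suc (len P)
    ; vert = λ { zero → x ; (suc a) → vert P a }
    ; edg = λ { zero → i ; (suc j) → edg P j }
    ; joins = λ { zero → x~P ; (suc j) → joins P j }
    ; edg-inj = λ { zero zero _ → refl ; zero (suc b) eq → ⊥-elim (unused b (sym eq))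
                  ; (suc a) zero eq → ⊥-elim (unused a eq)
                  ; (suc a) (suc b) eq → cong suc (edg-inj P a b eq) }
    ; init-inj = λ { zero zero _ → refl ; zero (suc b) eq → ⊥-elim (fresh b (sym eq))
                   ; (suc a) zero eq → ⊥-elim (fresh a eq)
                   ; (suc a) (suc b) eq → cong suc (inject₁-injective (P-inj _ _ eq)) }
    ; tail-inj = P-inj }

  prependEdge-injective : (P : Trail E) {x : Fin n} (i : EIdx E) (x~P : Joins (lookup E i) x (first P))
    (unused : ∀ j → edg P j ≢ i) (fresh : ∀ a → vert P (inject₁ a) ≢ x) (P-inj : VertexInjective P) →
    (∀ a → vert P a ≢ x) → VertexInjective (prependEdge P i x~P unused fresh P-inj)
  prependEdge-injective P i x~P unused fresh P-inj new zero    zero    _  = refl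
  prependEdge-injective P i x~P unused fresh P-inj new zero    (suc b) eq = ⊥-elim (new b (sym eq))
  prependEdge-injective P i x~P unused fresh P-inj new (suc a) zero    eq = ⊥-elim (new a eq)
  prependEdge-injective P i x~P unused fresh P-inj new (suc a) (suc b) eq = cong suc (P-inj a b eq)

module Walks {n : ℕ} (E : List (Edge n)) where

  Adjacent : Fin n → Fin n → Set
  Adjacent x y = ∃[ i ] Joins (lookup E i) x y

  data SimpleWalk : Fin n → Fin n → List (Fin n) → Set where
    stay : ∀ {z} → SimpleWalk z z (z ∷ [])
    step : ∀ {x y z vs} (i : EIdx E) → Joins (lookup E i) x y → SimpleWalk y z vs → x ∉ vs →
           SimpleWalk x z (x ∷ vs)

  suffix : ∀ {x z w vs} → SimpleWalk x z vs → w ∈ vs → ∃[ ws ] SimpleWalk w z ws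
  suffix stay           (here refl) = _ , stay
  suffix (step i j w f) (here refl) = _ , step i j w f
  suffix (step i j w f) (there m)   = suffix w m

  loopErase : ∀ {x z} → Star Adjacent x z → ∃[ vs ] SimpleWalk x z vs
  loopErase ε = _ , stay
  loopErase {x} ((i , x~y) ◅ walk) with loopErase walk
  ... | vs , w with DecMembership._∈?_ _≟_ x vs
  ...   | yes x∈vs = suffix w x∈vs
  ...   | no  x∉vs = _ , step i x~y w x∉vs

  record PathAlong (x z : Fin n) (vs : List (Fin n)) : Set where
    field
      trail    : Trail E
      distinct : VertexInjective trail
      starts   : first trail ≡ x
      ends     : last trail ≡ z
      within   : ∀ a → vert trail a ∈ vs

  walkPath : ∀ {x y z vs} (i : EIdx E) → Joins (lookup E i) x y → SimpleWalk y z vs → x ∉ vs →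
    PathAlong x z (x ∷ vs)
  walkPath i x~y stay x∉ = record
    { trail = edgeTrail {E = E} i x~y ; distinct = edgeTrail-injective {E = E} i x~y (λ eq → x∉ (here eq))
    ; starts = refl ; ends = refl
    ; within = λ { zero → here refl ; (suc zero) → there (here refl) } }
  walkPath {x} i x~y (step i′ y~y′ w y∉) x∉ = record
    { trail = prependEdge {E = E} trail i x~first unused (fresh ∘ inject₁) distinct
    ; distinct = prependEdge-injective {E = E} trail i x~first unused (fresh ∘ inject₁) distinct fresh
    ; starts = refl ; ends = ends
    ; within = λ { zero → here refl ; (suc a) → there (within a) } }
    where
    open PathAlong (walkPath i′ y~y′ w y∉)
    fresh : ∀ a → vert trail a ≢ x
    fresh a eq = x∉ (subst (_∈ _) eq (within a))
    x~first : Joins (lookup E i) x (first trail)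
    x~first = subst (Joins (lookup E i) x) (sym starts) x~y
    unused : ∀ j → edg trail j ≢ i
    unused j eq with joins-end (lookup E i) x~y
      (subst (λ e → Joins (lookup E e) (vert trail (inject₁ j)) (vert trail (suc j))) eq (joins trail j))
    ... | inj₁ q = fresh (inject₁ j) (sym q)
    ... | inj₂ q = fresh (suc j) (sym q)

module _ {n : ℕ} where

  closeWalk : (e : Edge n) {E : List (Edge n)} (X : Fin n → Sign) → Potential X E →
    ∀ {a b vs} → Walks.SimpleWalk E a b vs → Joins e b a →
    Σ (Trail (e ∷ E)) λ C → Closed C × trailSign C ≡ sgn e · (X a · X b)
  closeWalk e X pot {a} Walks.stay b~a =
    edgeTrail zero b~a , refl , cong (sgn e ·_) (sym (s*s≡+ (X a)))
  closeWalk e {E} X pot {a} {b} (Walks.step i a~y w a∉) b~a =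
    prependEdge lifted zero b~first (λ _ ()) fresh distinct , sym ends ,
    cong (sgn e ·_) (trans (trailSign-potential X pot trail) (cong₂ (λ u v → X u · X v) starts ends))
    where
    open Walks.PathAlong (Walks.walkPath E i a~y w a∉)
    lifted : Trail (e ∷ E)
    lifted = embedTrail tail-embedding trail
    b~first : Joins e b (first trail)
    b~first = subst (Joins e b) (sym starts) b~a
    fresh : ∀ k → vert trail (inject₁ k) ≢ b
    fresh k eq = fromℕ≢inject₁ (sym (distinct _ _ (trans eq (sym ends))))

  module Switching (X : Fin n → Sign) {R : Fin n → Set} (R? : Decidable R) where

    switched : Fin n → Sign
    switched v with R? v
    ... | yes _ = opposite (X v)
    ... | no  _ = X v

    switched-in : ∀ {v} → R v → switched v ≡ opposite (X v)
    switched-in {v} r with R? v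
    ... | yes _ = refl
    ... | no ¬r = ⊥-elim (¬r r)

    switched-out : ∀ {v} → ¬ R v → switched v ≡ X v
    switched-out {v} ¬r with R? v
    ... | yes r = ⊥-elim (¬r r)
    ... | no _  = refl

    switched-fits : ∀ f → (R (end₁ f) ⇔ R (end₂ f)) → Fits X f → Fits switched f
    switched-fits f same fit = by-side (R? (end₁ f))
      where
      by-side : Dec (R (end₁ f)) → Fits switched f
      by-side (yes r) = trans fit (sym (trans (cong₂ _·_ (switched-in r) (switched-in (to same r)))
                                             (opposite-·-opposite (X (end₁ f)) (X (end₂ f)))))
      by-side (no ¬r) = trans fit (sym (cong₂ _·_ (switched-out ¬r) (switched-out (¬r ∘ from same))))

  -- If X does not fit the new edge e = ab,
  -- then a and b are not connected in E (a path would close to a negative circle),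
  -- and switching X on the component of a makes e fit while keeping E.
  extend-potential : (e : Edge n) (E : List (Edge n)) → Balanced (e ∷ E) →
    (X : Fin n → Sign) → Potential X E → ¬ ¬ Switchable (e ∷ E)
  extend-potential e E bal X pot with sgn e ≟ₛ X (end₁ e) · X (end₂ e)
  ... | yes fit = return (X , fit ∷ pot)
  ... | no misfit = ¬¬-excluded-middle {A = Star Adjacent a b} >>= λ
    { (yes walk) → ⊥-elim (misfit (connected-fit (proj₂ (loopErase walk))))
    ; (no apart) → sequence rawApplicative (λ v → ¬¬-excluded-middle {A = Star Adjacent a v}) >>= λ component? →
        return (switched component? , e-fits component? apart ∷ E-fits component?) }
    where
    open Walks E
    a = end₁ e
    b = end₂ e
    open Switching X

    connected-fit : ∀ {vs} → SimpleWalk a b vs → sgn e ≡ X a · X b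
    connected-fit w with closeWalk e X pot w (inj₂ (refl , refl))
    ... | C , closed , sign = *-cancelʳ-≡ (X a · X b) _ _ (begin
      sgn e · (X a · X b) ≡⟨ sign ⟨
      trailSign C         ≡⟨ bal C closed ⟩
      ⊕                   ≡⟨ s*s≡+ (X a · X b) ⟨
      (X a · X b) · (X a · X b) ∎)

    e-fits : (component? : Decidable (Star Adjacent a)) → ¬ Star Adjacent a b → Fits (switched component?) e
    e-fits component? apart = begin
      sgn e                  ≡⟨ ≢⇒opposite misfit ⟩
      opposite (X a · X b)   ≡⟨ *-assoc ⊖ (X a) (X b) ⟨
      opposite (X a) · X b   ≡⟨ cong₂ _·_ (switched-in component? ε) (switched-out component? apart) ⟨
      switched component? a · switched component? b ∎

    E-fits : (component? : Decidable (Star Adjacent a)) → Potential (switched component?) E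
    E-fits component? = All-tabulate E λ i →
      switched-fits component? (lookup E i)
        (mk⇔ (λ w → w ◅◅ ((i , inj₁ (refl , refl)) ◅ ε)) (λ w → w ◅◅ ((i , inj₂ (refl , refl)) ◅ ε)))
        (potential-lookup X pot i)

  balanced⇒¬¬switchable : ∀ E → Balanced E → ¬ ¬ Switchable E
  balanced⇒¬¬switchable []      _   = return ((λ _ → ⊕) , [])
  balanced⇒¬¬switchable (e ∷ E) bal =
    balanced⇒¬¬switchable E (balanced-tail bal) >>= λ (X , pot) → extend-potential e E bal X pot

  subsetPotential : Subset n → Fin n → Sign
  subsetPotential p v = fromBool (Vec.lookup p v)

  subsetPotential-code : ∀ X v → subsetPotential (Vec.tabulate (isNegative ∘ X)) v ≡ X v
  subsetPotential-code X v =
    trans (cong fromBool (lookup∘tabulate (isNegative ∘ X) v)) (fromBool-isNegative (X v))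

  -- there are finitely many candidate potentials, so switchability is decidable
  switchable? : ∀ E → Dec (Switchable E)
  switchable? E = map′
    (λ (p , pot) → subsetPotential p , pot)
    (λ (X , pot) → Vec.tabulate (isNegative ∘ X) , potential-cong (subsetPotential-code X) pot)
    (anySubset? λ p → All.all? (λ f → sgn f ≟ₛ subsetPotential p (end₁ f) · subsetPotential p (end₂ f)) E)

  balanced⇔switchable : ∀ E → Balanced E ⇔ Switchable E
  balanced⇔switchable E = mk⇔
    (λ bal → decidable-stable (switchable? E) (balanced⇒¬¬switchable E bal))
    switchable⇒balanced

-- A graph has a potential iff its negative edges are none or form a cut; the
-- shore of the cut is where the potential is negative.

module _ {n : ℕ} where

  cut⇒switchable : (E : List (Edge n)) → NegEmptyOrCut E → Switchable E
  cut⇒switchable E (inj₁ allPositive) = (λ _ → ⊕) , All-tabulate E allPositive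
  cut⇒switchable E (inj₂ (_ , shore , negative⇔crossing)) = fromBool ∘ shore , All-tabulate E λ i →
    sign-ext _ _ (⇔-sym (fromBool-·-negative⇔ _ _) ⇔-∘ negative⇔crossing i)

  switchable⇒cut : (E : List (Edge n)) → Switchable E → NegEmptyOrCut E
  switchable⇒cut E (X , pot) with all? (λ i → sgn (lookup E i) ≟ₛ ⊕)
  ... | yes allPositive = inj₁ allPositive
  ... | no notAll with ¬∀⟶∃¬ _ _ (λ i → sgn (lookup E i) ≟ₛ ⊕) notAll
  ...   | i , notPositive = inj₂ ((i , ≢⇒opposite notPositive) , isNegative ∘ X ,
          crossing⇔negative)
    where
    crossing⇔negative : ∀ e → Negative E e ⇔ (isNegative (X (end₁ (lookup E e))) ≢ isNegative (X (end₂ (lookup E e))))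
    crossing⇔negative e = subst (λ s → (s ≡ ⊖) ⇔ (isNegative (X x) ≢ isNegative (X y)))
      (sym (potential-lookup X pot e)) (·-negative⇔ (X x) (X y))
      where
      x = end₁ (lookup E e)
      y = end₂ (lookup E e)

module _ {n : ℕ} (v : Fin (suc n)) where

  renamed-potential : ∀ X {rest′ rest} → Pointwise (RenamedFrom v) rest′ rest →
    Potential X rest → Potential (X ∘ punchIn v) rest′
  renamed-potential X [] [] = []
  renamed-potential X ((p₁ , p₂ , s) ∷ renamed) (fit ∷ fits) =
    trans s (trans fit (cong₂ (λ a b → X a · X b) (sym p₁) (sym p₂))) ∷ renamed-potential X renamed fits

  renamed-potential⁻ : ∀ X {rest′ rest} → Pointwise (RenamedFrom v) rest′ rest →
    Potential (X ∘ punchIn v) rest′ → Potential X rest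
  renamed-potential⁻ X [] [] = []
  renamed-potential⁻ X ((p₁ , p₂ , s) ∷ renamed) (fit ∷ fits) =
    trans (sym s) (trans fit (cong₂ (λ a b → X a · X b) p₁ p₂)) ∷ renamed-potential⁻ X renamed fits

-- Forwards, a potential restricts to the remaining vertices: the merged edge uw
-- has sign σ(uv)σ(vw) = X(u)X(v)X(v)X(w) = X(u)X(w).
suppress-forward : ∀ {Σ₀ Σ₁} → Suppress Σ₀ Σ₁ → Switchable (edges Σ₀) → Switchable (edges Σ₁)
suppress-forward (suppress v e₁ e₂ rest u w rest′ perm u~v v~w renamed) (X , pot)
  with All-resp-↭ perm pot
... | fit₁ ∷ fit₂ ∷ fits = X ∘ punchIn v , merged ∷ renamed-potential v X renamed fits
  where
  merged : sgn e₁ · sgn e₂ ≡ X (punchIn v u) · X (punchIn v w)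
  merged = trans (cong₂ _·_ (fits-joins X fit₁ u~v) (fits-joins X fit₂ v~w))
                 (·-telescope (X (punchIn v u)) (X v) (X (punchIn v w)))

-- Backwards, a potential X′ extends by the value X′(u)·σ(uv) at the suppressed vertex.
suppress-backward : ∀ {Σ₀ Σ₁} → Suppress Σ₀ Σ₁ → Switchable (edges Σ₁) → Switchable (edges Σ₀)
suppress-backward (suppress v e₁ e₂ rest u w rest′ perm u~v v~w renamed) (X′ , merged ∷ fits) =
  X , All-resp-↭ (↭-sym perm)
    (joins-fits X u~v fit₁ ∷ joins-fits X v~w fit₂ ∷
     renamed-potential⁻ v X renamed (potential-cong (insertAt-punchIn X′ v b) fits))
  where
  b = X′ u · sgn e₁
  X = insertAt X′ v b
  fit₁ : sgn e₁ ≡ X (punchIn v u) · X v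
  fit₁ = begin
    sgn e₁                 ≡⟨ ·-cancelˡ-twice (X′ u) (sgn e₁) ⟨
    X′ u · b               ≡⟨ cong₂ _·_ (insertAt-punchIn X′ v b u) (insertAt-lookup X′ v b) ⟨
    X (punchIn v u) · X v  ∎
  fit₂ : sgn e₂ ≡ X v · X (punchIn v w)
  fit₂ = begin
    sgn e₂                      ≡⟨ ·-cancelˡ-twice (sgn e₁) (sgn e₂) ⟨
    sgn e₁ · (sgn e₁ · sgn e₂)  ≡⟨ cong (sgn e₁ ·_) merged ⟩
    sgn e₁ · (X′ u · X′ w)      ≡⟨ *-assoc (sgn e₁) (X′ u) (X′ w) ⟨
    (sgn e₁ · X′ u) · X′ w      ≡⟨ cong (_· X′ w) (*-comm (sgn e₁) (X′ u)) ⟩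
    b · X′ w                    ≡⟨ cong₂ _·_ (insertAt-lookup X′ v b) (insertAt-punchIn X′ v b w) ⟨
    X v · X (punchIn v w)       ∎

suppressions-preserve : ∀ {Σ₀ Σ₁} → Star Suppress Σ₀ Σ₁ → Switchable (edges Σ₀) ⇔ Switchable (edges Σ₁)
suppressions-preserve ε        = mk⇔ id id
suppressions-preserve (s ◅ ss) = suppressions-preserve ss ⇔-∘ mk⇔ (suppress-forward s) (suppress-backward s)

module _ {n : ℕ} (v : Fin (suc n)) where

  AtV NotLoopAtV : Edge (suc n) → Set
  AtV e        = end₁ e ≡ v ⊎ end₂ e ≡ v
  NotLoopAtV e = ¬ (end₁ e ≡ v × end₂ e ≡ v)

  endsAtV : ∀ {a b} → Dec (a ≡ v) → Dec (b ≡ v) → ℕ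
  endsAtV a? b? = (if does a? then 1 else 0) + (if does b? then 1 else 0)

  one-end-at-v : ∀ {a b} (a? : Dec (a ≡ v)) (b? : Dec (b ≡ v)) →
    ¬ (a ≡ v × b ≡ v) → a ≡ v ⊎ b ≡ v → endsAtV a? b? ≡ 1
  one-end-at-v (yes p) (yes q) notLoop _ = ⊥-elim (notLoop (p , q))
  one-end-at-v (yes _) (no _)  _ _       = refl
  one-end-at-v (no _)  (yes _) _ _       = refl
  one-end-at-v (no p)  (no q)  _ atV     = ⊥-elim ([ p , q ] atV)

  no-end-at-v : ∀ {a b} (a? : Dec (a ≡ v)) (b? : Dec (b ≡ v)) → ¬ (a ≡ v ⊎ b ≡ v) → endsAtV a? b? ≡ 0
  no-end-at-v (yes p) _       away = ⊥-elim (away (inj₁ p))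
  no-end-at-v (no _)  (yes q) away = ⊥-elim (away (inj₂ q))
  no-end-at-v (no _)  (no _)  _    = refl

  record SplitAtV (E : List (Edge (suc n))) : Set where
    field
      atV away   : List (Edge (suc n))
      split-perm : E ↭ atV ++ away
      atV-ok     : All (λ e → AtV e × NotLoopAtV e) atV
      away-ok    : All (λ e → ¬ AtV e) away
      deg-atV    : deg E v ≡ length atV

  splitAtV : (E : List (Edge (suc n))) → All NotLoopAtV E → SplitAtV E
  splitAtV []      []                = record { atV = [] ; away = [] ; split-perm = ↭-refl
    ; atV-ok = [] ; away-ok = [] ; deg-atV = refl }
  splitAtV (e ∷ E) (notLoop ∷ notLoops) with splitAtV E notLoops | (end₁ e ≟ v) ⊎-dec (end₂ e ≟ v)
  ... | s | yes atV = record { atV = e ∷ SplitAtV.atV s ; away = SplitAtV.away s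
    ; split-perm = prep e (SplitAtV.split-perm s)
    ; atV-ok = (atV , notLoop) ∷ SplitAtV.atV-ok s ; away-ok = SplitAtV.away-ok s
    ; deg-atV = cong₂ _+_ (one-end-at-v (end₁ e ≟ v) (end₂ e ≟ v) notLoop atV) (SplitAtV.deg-atV s) }
  ... | s | no away = record { atV = SplitAtV.atV s ; away = e ∷ SplitAtV.away s
    ; split-perm = ↭-trans (prep e (SplitAtV.split-perm s)) (↭-sym (shift e (SplitAtV.atV s) (SplitAtV.away s)))
    ; atV-ok = SplitAtV.atV-ok s ; away-ok = away ∷ SplitAtV.away-ok s
    ; deg-atV = trans (cong (_+ deg E v) (no-end-at-v (end₁ e ≟ v) (end₂ e ≟ v) away)) (SplitAtV.deg-atV s) }

  other-end : (e : Edge (suc n)) → AtV e → NotLoopAtV e → ∃[ u ] Joins e (punchIn v u) v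
  other-end e atV notLoop with end₂ e ≟ v
  ... | yes q = punchOut (λ eq → notLoop (sym eq , q)) , inj₁ (sym (punchIn-punchOut _) , q)
  ... | no q with atV
  ...   | inj₁ p = punchOut (λ eq → q (sym eq)) , inj₂ (p , sym (punchIn-punchOut _))
  ...   | inj₂ p = ⊥-elim (q p)

  rename-away : (rest : List (Edge (suc n))) → All (λ e → ¬ AtV e) rest →
    ∃[ rest′ ] Pointwise (RenamedFrom v) rest′ rest
  rename-away []         []           = [] , []
  rename-away (e ∷ rest) (away ∷ aways) with rename-away rest aways
  ... | rest′ , renamed =
    edge (punchOut (λ eq → away (inj₁ (sym eq)))) (punchOut (λ eq → away (inj₂ (sym eq)))) (sgn e) ∷ rest′ ,
    (punchIn-punchOut _ , punchIn-punchOut _ , refl) ∷ renamed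

  suppressible : (E : List (Edge (suc n))) → deg E v ≡ 2 → ¬ LoopAt E v →
    ∃[ E′ ] Suppress (sgraph (suc n) E) (sgraph n E′)
  suppressible E divalent noLoop = from-split (splitAtV E (All-tabulate E λ i loop → noLoop (i , loop)))
    where
    from-split : SplitAtV E → ∃[ E′ ] Suppress (sgraph (suc n) E) (sgraph n E′)
    from-split record { atV = e₁ ∷ e₂ ∷ [] ; away = rest ; split-perm = perm
                      ; atV-ok = (at₁ , nl₁) ∷ (at₂ , nl₂) ∷ [] ; away-ok = aways }
      with other-end e₁ at₁ nl₁ | other-end e₂ at₂ nl₂ | rename-away rest aways
    ... | u , u~v | w , w~v | rest′ , renamed =
      edge u w (sgn e₁ · sgn e₂) ∷ rest′ , suppress v e₁ e₂ rest u w rest′ perm u~v (joins-sym e₂ w~v) renamed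
    from-split record { atV = [] ; deg-atV = d } with trans (sym divalent) d
    ... | ()
    from-split record { atV = _ ∷ [] ; deg-atV = d } with trans (sym divalent) d
    ... | ()
    from-split record { atV = _ ∷ _ ∷ _ ∷ _ ; deg-atV = d } with trans (sym divalent) d
    ... | ()

loopAt? : ∀ {n} (E : List (Edge n)) v → Dec (LoopAt E v)
loopAt? E v = any? λ i → (end₁ (lookup E i) ≟ v) ×-dec (end₂ (lookup E i) ≟ v)

-- each suppression removes a vertex, so repeated suppression terminates
suppressAll-exists : ∀ n (E : List (Edge n)) → ∃[ Σ₁ ] SuppressAll (sgraph n E) Σ₁
suppressAll-exists zero    E = sgraph zero E , ε , λ ()
suppressAll-exists (suc n) E with all? (λ v → (deg E v ℕ.≟ 2) →-dec loopAt? E v)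
... | yes done = sgraph (suc n) E , ε , done
... | no notDone with ¬∀⟶∃¬ _ _ (λ v → (deg E v ℕ.≟ 2) →-dec loopAt? E v) notDone
...   | v , suppressibleAtV with deg E v ℕ.≟ 2 | loopAt? E v
...     | no notDivalent | _       = ⊥-elim (suppressibleAtV (λ d → ⊥-elim (notDivalent d)))
...     | yes _          | yes loop = ⊥-elim (suppressibleAtV (λ _ → loop))
...     | yes divalent   | no noLoop with suppressible v E divalent noLoop
...       | E′ , first-step with suppressAll-exists n E′
...         | Σ₁ , steps , done = Σ₁ , first-step ◅ steps , done

module _ {n : ℕ} where
  open EdgeEmbedding

  restrict-embedding : (E : List (Edge n)) (S : ESet E) → EdgeEmbedding (restrict E S) E
  restrict-embedding []      S = record { φ = λ () ; φ-lookup = λ () ; φ-injective = λ () }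
  restrict-embedding (e ∷ E) S with mem S zero
  ... | true  = record
    { φ = λ { zero → zero ; (suc i) → suc (φ rest i) }
    ; φ-lookup = λ { zero → refl ; (suc i) → φ-lookup rest i }
    ; φ-injective = λ { zero zero _ → refl ; (suc i) (suc j) eq → cong suc (φ-injective rest i j (suc-injective eq)) } }
    where rest = restrict-embedding E (eset (mem S ∘ suc))
  ... | false = record
    { φ = suc ∘ φ rest ; φ-lookup = φ-lookup rest
    ; φ-injective = λ i j eq → φ-injective rest i j (suc-injective eq) }
    where rest = restrict-embedding E (eset (mem S ∘ suc))

  restrict-hits : (E : List (Edge n)) (S : ESet E) (i : EIdx E) → i ∈ₑ S →
    ∃[ j ] φ (restrict-embedding E S) j ≡ i
  restrict-hits (e ∷ E) S zero i∈S with mem S zero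
  ... | true  = zero , refl
  ... | false = ⊥-elim i∈S
  restrict-hits (e ∷ E) S (suc i) i∈S with mem S zero | restrict-hits E (eset (mem S ∘ suc)) i i∈S
  ... | true  | j , hit = suc j , cong suc hit
  ... | false | j , hit = j , cong suc hit

  balanced-restrict : (E : List (Edge n)) (S : ESet E) → Balanced E → Balanced (restrict E S)
  balanced-restrict E S = balanced-embedding (restrict-embedding E S)

  restrict-circle : (E : List (Edge n)) (S : ESet E) (C : Trail E) → Closed C → TrailIn S C →
    Σ (Trail (restrict E S)) λ C′ → Closed C′ × trailSign C′ ≡ trailSign C
  restrict-circle E S C closed inS =
    retarget C g same g-inj , closed , retarget-sign {E = E} {F = restrict E S} C g same g-inj
    where
    m = restrict-embedding E S
    g : Fin (suc (len C)) → EIdx (restrict E S)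
    g j = proj₁ (restrict-hits E S (edg C j) (inS j))
    hit : ∀ j → φ m (g j) ≡ edg C j
    hit j = proj₂ (restrict-hits E S (edg C j) (inS j))
    same : ∀ j → lookup (restrict E S) (g j) ≡ lookup E (edg C j)
    same j = trans (sym (φ-lookup m (g j))) (cong (lookup E) (hit j))
    g-inj : ∀ a b → g a ≡ g b → a ≡ b
    g-inj a b eq = edg-inj C a b (trans (sym (hit a)) (trans (cong (φ m) eq) (hit b)))

  module _ {E : List (Edge n)} where

    StrictlyExtends : ESet E → ESet E → Set
    StrictlyExtends S S′ = S ⊆ₑ S′ × ∃[ e ] (e ∈ₑ S′ × ¬ e ∈ₑ S)

    Maximal : (ESet E → Set) → ESet E → Set
    Maximal Q S = ∀ S′ → S ⊆ₑ S′ → Q S′ → S′ ⊆ₑ S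

    size : ESet E → ℕ
    size S = ∣ Vec.tabulate (mem S) ∣

    ∈-tabulate : ∀ (S : ESet E) {e} → e ∈ₑ S → e ∈ˢ Vec.tabulate (mem S)
    ∈-tabulate S {e} e∈S = lookup⇒[]= e _ (trans (lookup∘tabulate (mem S) e) (to T-≡ e∈S))

    ∈-tabulate⁻ : ∀ (S : ESet E) {e} → e ∈ˢ Vec.tabulate (mem S) → e ∈ₑ S
    ∈-tabulate⁻ S {e} m = from T-≡ (trans (sym (lookup∘tabulate (mem S) e)) ([]=⇒lookup m))

    strict⇒size< : ∀ {S S′} → StrictlyExtends S S′ → size S < size S′
    strict⇒size< {S} {S′} (S⊆S′ , e , e∈S′ , e∉S) =
      p⊂q⇒∣p∣<∣q∣ {p = Vec.tabulate (mem S)} {q = Vec.tabulate (mem S′)}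
        ((λ m → ∈-tabulate S′ (S⊆S′ _ (∈-tabulate⁻ S m))) , e , ∈-tabulate S′ e∈S′ , e∉S ∘ ∈-tabulate⁻ S)

    -- a set with no strict extension in Q is maximal in Q (membership is decidable)
    unextendable⇒maximal : ∀ {Q S} → ¬ (∃[ S′ ] (StrictlyExtends S S′ × Q S′)) → Maximal Q S
    unextendable⇒maximal {S = S} none S′ S⊆S′ qS′ e e∈S′ =
      decidable-stable (T? (mem S e)) (λ e∉S → none (S′ , (S⊆S′ , e , e∈S′ , e∉S) , qS′))

    -- classically, every Q-set extends to a maximal Q-set: strict extensions
    -- increase the size, which is bounded by the number of edges
    ¬¬maximal-extension : (Q : ESet E → Set) (S₀ : ESet E) → Q S₀ →
      ¬ ¬ (Σ (ESet E) λ S → S₀ ⊆ₑ S × Q S × Maximal Q S)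
    ¬¬maximal-extension Q S₀ q₀ = grow (length E) S₀ q₀ (λ _ x → x) (m≤n+m (length E) (size S₀))
      where
      -- invariant of the search: length E ≤ size S + k, so k bounds the remaining steps
      Goal = Σ (ESet E) λ S → S₀ ⊆ₑ S × Q S × Maximal Q S
      grow : ∀ k S → Q S → S₀ ⊆ₑ S → length E ≤ size S + k → ¬ ¬ Goal
      grow-past : ∀ k {S S′} → StrictlyExtends S S′ → Q S′ → S₀ ⊆ₑ S′ → length E ≤ size S + k → ¬ ¬ Goal
      grow k S qS S₀⊆S bound = ¬¬-excluded-middle {A = ∃[ S′ ] (StrictlyExtends S S′ × Q S′)} >>= λ
        { (no none) → return (S , S₀⊆S , qS , unextendable⇒maximal none)
        ; (yes (S′ , strict , qS′)) → grow-past k strict qS′ (λ e e∈S₀ → proj₁ strict e (S₀⊆S e e∈S₀)) bound }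
      grow-past zero {S} {S′} strict _ _ bound = ⊥-elim (<⇒≱ (strict⇒size< strict)
        (≤-trans (∣p∣≤n (Vec.tabulate (mem S′))) (≤-trans bound (≤-reflexive (+-identityʳ (size S))))))
      grow-past (suc k) {S} {S′} strict qS′ S₀⊆S′ bound = grow k S′ qS′ S₀⊆S′
        (≤-trans bound (≤-trans (≤-reflexive (+-suc (size S) k)) (+-monoˡ-≤ k (strict⇒size< strict))))

  -- classically, every circle lies in a nontrivial block: a maximal cocircular
  -- edge set containing its edges
  ¬¬block-containing : (E : List (Edge n)) (C : Trail E) → Closed C →
    ¬ ¬ (Σ (ESet E) λ B → NontrivialBlock E B × TrailIn B C)
  ¬¬block-containing E C closed = (λ (B , C⊆B , cocircular , maximal) →
      B , ((edg C zero , C⊆B _ (inC zero)) , cocircular , maximal) , λ j → C⊆B _ (inC j))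
    <$> ¬¬maximal-extension (Cocircular E) edgesOfC (λ e f e∈C f∈C → C , closed , inC , toWitness e∈C , toWitness f∈C)
    where
    edgesOfC : ESet E
    edgesOfC = eset λ e → isYes (any? λ j → edg C j ≟ e)
    inC : ∀ j → edg C j ∈ₑ edgesOfC
    inC j = fromWitness (j , refl)

  blocks-balanced⇒balanced : (E : List (Edge n)) →
    (∀ B → NontrivialBlock E B → Balanced (restrict E B)) → Balanced E
  blocks-balanced⇒balanced E blocks C closed = decidable-stable (trailSign C ≟ₛ ⊕)
    ((λ (B , block , C⊆B) → circle-positive B block C⊆B) <$> ¬¬block-containing E C closed)
    where
    circle-positive : ∀ B → NontrivialBlock E B → TrailIn B C → trailSign C ≡ ⊕
    circle-positive B block C⊆B with restrict-circle E B C closed C⊆B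
    ... | C′ , closed′ , sign = trans (sym sign) (blocks B block C′ closed′)

data Position (m : ℕ) : Fin (suc (suc m)) → Set where
  start    : Position m zero
  end      : Position m (fromℕ (suc m))
  internal : (i : Fin m) → Position m (suc (inject₁ i))

position : ∀ m (k : Fin (suc (suc m))) → Position m k
position m       zero       = start
position zero    (suc zero) = end
position (suc m) (suc k) with position m k
... | start      = internal zero
... | end        = end
... | internal i = internal (suc i)

prefix : (k : ℕ) → (Fin k → Sign) → Fin (suc k) → Sign
prefix k       s zero    = ⊕
prefix (suc k) s (suc i) = s zero · prefix k (s ∘ suc) i

prefix-step : ∀ k (s : Fin (suc k) → Sign) j → prefix (suc k) s (suc j) ≡ prefix (suc k) s (inject₁ j) · s j
prefix-step k       s zero    = *-identityʳ (s zero)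
prefix-step (suc k) s (suc j) =
  trans (cong (s zero ·_) (prefix-step k (s ∘ suc) j)) (sym (*-assoc (s zero) _ _))

prefix-last : ∀ {n} k (s : Fin k → Sign) → prefix k s (fromℕ k) ≡ prodSign {n} k s
prefix-last zero    s = refl
prefix-last {n} (suc k) s = cong (s zero ·_) (prefix-last {n} k (s ∘ suc))

-- A potential X′ of Γ′ extends to a subdivision Γ when each subdividing path has
-- the sign of the edge it replaces: along the path of e′ = ab, the k-th vertex
-- gets X′(a) times the sign of the first k edges, ending at X′(a)σ(e′) = X′(b).
module SubdivisionPotential {n′ n : ℕ} {E′ : List (Edge n′)} {E : List (Edge n)} (S : Subdivision E′ E)
  (X′ : Fin n′ → Sign) (pot′ : Potential X′ E′)
  (path-sign : ∀ e′ → trailSign (sub S e′) ≡ sgn (lookup E′ e′)) where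

  edgeSigns : (e′ : EIdx E′) → Fin (suc (len (sub S e′))) → Sign
  edgeSigns e′ j = sgn (lookup E (edg (sub S e′) j))

  along : (e′ : EIdx E′) → Fin (suc (suc (len (sub S e′)))) → Sign
  along e′ k = X′ (end₁ (lookup E′ e′)) · prefix _ (edgeSigns e′) k

  valueBy : (v : Fin n) → (∃[ x ] ι S x ≡ v) ⊎ (∃[ e′ ] InternalP (sub S e′) v) → Sign
  valueBy v (inj₁ (x , _))       = X′ x
  valueBy v (inj₂ (e′ , i , _)) = along e′ (suc (inject₁ i))

  X : Fin n → Sign
  X v = valueBy v (vertex-cover S v)

  module _ (e′ : EIdx E′) where
    private
      P = sub S e′
      a = end₁ (lookup E′ e′)
      b = end₂ (lookup E′ e′)

    at-start : ∀ c → valueBy (vert P zero) c ≡ along e′ zero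
    at-start (inj₁ (x , ιx)) = trans (cong X′ (ι-inj S _ _ (trans ιx (sub-first S e′)))) (sym (*-identityʳ (X′ a)))
    at-start (inj₂ (f′ , i , eq)) = ⊥-elim (internal-new S f′ _ (i , eq) a (sym (sub-first S e′)))

    at-end : ∀ c → valueBy (vert P (fromℕ (suc (len P)))) c ≡ along e′ (fromℕ (suc (len P)))
    at-end (inj₁ (x , ιx)) = begin
      X′ x                  ≡⟨ cong X′ (ι-inj S _ _ (trans ιx (sub-last S e′))) ⟩
      X′ b                  ≡⟨ ·-cancelˡ-twice (X′ a) (X′ b) ⟨
      X′ a · (X′ a · X′ b)  ≡⟨ cong (X′ a ·_) (potential-lookup X′ pot′ e′) ⟨
      X′ a · sgn (lookup E′ e′) ≡⟨ cong (X′ a ·_) (path-sign e′) ⟨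
      X′ a · trailSign P    ≡⟨ cong (X′ a ·_) (prefix-last {n} _ (edgeSigns e′)) ⟨
      along e′ (fromℕ (suc (len P))) ∎
    at-end (inj₂ (f′ , i , eq)) = ⊥-elim (internal-new S f′ _ (i , eq) b (sym (sub-last S e′)))

    at-internal : ∀ (i : Fin (len P)) c → valueBy (vert P (suc (inject₁ i))) c ≡ along e′ (suc (inject₁ i))
    at-internal i (inj₁ (x , ιx)) = ⊥-elim (internal-new S e′ _ (i , refl) x ιx)
    at-internal i (inj₂ (f′ , i′ , eq)) = same-path f′ (internal-disj S f′ e′ _ (i′ , eq) (_ , refl)) i′ eq
      where
      same-path : ∀ f′ → f′ ≡ e′ → ∀ i′ → vert (sub S f′) (suc (inject₁ i′)) ≡ vert P (suc (inject₁ i)) →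
        along f′ (suc (inject₁ i′)) ≡ along e′ (suc (inject₁ i))
      same-path .e′ refl i′ eq = cong (λ j → along e′ (suc (inject₁ j))) (inject₁-injective (tail-inj P _ _ eq))

    X-along : ∀ k → X (vert P k) ≡ along e′ k
    X-along k with position (len P) k
    ... | start      = at-start (vertex-cover S _)
    ... | end        = at-end (vertex-cover S _)
    ... | internal i = at-internal i (vertex-cover S _)

  potential : Potential X E
  potential = All-tabulate E edge-fits
    where
    edge-fits : ∀ e → Fits X (lookup E e)
    edge-fits e with edge-cover S e
    ... | e′ , j , refl = joins-fits X (joins (sub S e′) j) (begin
      s                                 ≡⟨ ·-cancelˡ-twice (a · p) s ⟨
      (a · p) · ((a · p) · s)           ≡⟨ cong ((a · p) ·_) (*-assoc a p s) ⟩
      (a · p) · (a · (p · s))           ≡⟨ cong (λ q → (a · p) · (a · q)) (prefix-step _ (edgeSigns e′) j) ⟨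
      along e′ (inject₁ j) · along e′ (suc j)
        ≡⟨ cong₂ _·_ (X-along e′ (inject₁ j)) (X-along e′ (suc j)) ⟨
      X (vert (sub S e′) (inject₁ j)) · X (vert (sub S e′) (suc j)) ∎)
      where
      a = X′ (end₁ (lookup E′ e′))
      p = prefix _ (edgeSigns e′) (inject₁ j)
      s = edgeSigns e′ j

  switchable : Switchable E
  switchable = X , potential

suppression-preserves-balance : ∀ (Σ₀ Σ₁ : SGraph) → SuppressAll Σ₀ Σ₁ →
  (Balanced (edges Σ₀) ⇔ Balanced (edges Σ₁))
suppression-preserves-balance Σ₀ Σ₁ (steps , _) =
  ⇔-sym (balanced⇔switchable _) ⇔-∘ (suppressions-preserve steps ⇔-∘ balanced⇔switchable _)

-- (b) balance is tested blockwise after suppression; this holds for every signed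
-- graph, in particular for those obtained by Construction A
balance-via-blocks : ∀ {n : ℕ} (E : List (Edge n)) →
  (Balanced E ⇔ (∀ B → NontrivialBlock E B →
     ∀ Σ₁ → SuppressAll (sgraph n (restrict E B)) Σ₁ → NegEmptyOrCut (edges Σ₁)))
balance-via-blocks {n} E = mk⇔
  (λ bal B _ Σ₁ (steps , _) → switchable⇒cut _
     (to (suppressions-preserve steps) (to (balanced⇔switchable _) (balanced-restrict E B bal))))
  (λ cuts → blocks-balanced⇒balanced E λ B block →
     let (Σ₁ , steps , done) = suppressAll-exists n (restrict E B)
     in switchable⇒balanced (from (suppressions-preserve steps)
          (cut⇒switchable _ (cuts B block Σ₁ (steps , done)))))

-- In Construction D every subdivided edge keeps its sign: edges of F′ by Step 6(a);
-- the others are positive (Step 2) and become all-positive paths (Step 5).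
subdivision-signs : ∀ {n′ n} {E′ : List (Edge n′)} {E : List (Edge n)} (F′ : ESet E′) (S : Subdivision E′ E) →
  (∀ e′ → Negative E′ e′ → e′ ∈ₑ F′) →
  (∀ e′ → e′ ∈ₑ F′ → trailSign (sub S e′) ≡ sgn (lookup E′ e′)) →
  (∀ e′ → ¬ (e′ ∈ₑ F′) → ∀ e → HasEdge (sub S e′) e → sgn (lookup E e) ≡ ⊕) →
  ∀ e′ → trailSign (sub S e′) ≡ sgn (lookup E′ e′)
subdivision-signs {n = n} {E′} F′ S negatives-in-F′ F′-signs outside-positive e′ with T? (mem F′ e′)
... | yes inF′  = F′-signs e′ inF′
... | no  outF′ = trans (prodSign-positive {n} _ _ (λ j → outside-positive e′ outF′ _ (j , refl)))
  (sym (decidable-stable (sgn (lookup E′ e′) ≟ₛ ⊕)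
    (λ notPositive → outF′ (negatives-in-F′ e′ (≢⇒opposite notPositive)))))

-- (c) Construction D yields a balanced signed graph: Σ′ is balanced (its blocks
-- are), and a potential of Σ′ extends along the subdivision
construction-D-balanced : ∀ {n′ n : ℕ} (E′ : List (Edge n′)) (E : List (Edge n)) → ConstructionD E′ E → Balanced E
construction-D-balanced E′ E
  (_ , blocks , F′ , negatives-in-F′ , _ , _ , _ , covered , _ , _ , S , outside-positive , step6 , _) =
  switchable⇒balanced (SubdivisionPotential.switchable S X′ pot′ path-sign)
  where
  Σ′-switchable = to (balanced⇔switchable E′) (blocks-balanced⇒balanced E′ blocks)
  X′ = proj₁ Σ′-switchable
  pot′ = proj₂ Σ′-switchable
  path-sign = subdivision-signs F′ S negatives-in-F′
    (λ e′ e′∈F′ → proj₁ (step6 (proj₁ (covered e′ e′∈F′)) e′ (proj₂ (covered e′ e′∈F′))))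
    outside-positive

lemma4p2 : (∀ (Σ₀ Σ₁ : SGraph) → SuppressAll Σ₀ Σ₁ → (Balanced (edges Σ₀) ⇔ Balanced (edges Σ₁)))
    × (∀ {n : ℕ} (E : List (Edge n)) → ConstructionA E →
         (Balanced E ⇔ (∀ B → NontrivialBlock E B →
            ∀ Σ₁ → SuppressAll (sgraph n (restrict E B)) Σ₁ → NegEmptyOrCut (edges Σ₁))))
    × (∀ {n' n : ℕ} (E' : List (Edge n')) (E : List (Edge n)) → ConstructionD E' E → Balanced E)
lemma4p2 = suppression-preserves-balance , (λ E _ → balance-via-blocks E) , construction-D-balanced
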